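{- For every $n\ge1$, every integer $k$ and every $\sigma\in\Sigma^B(n)$, the number of $w\in B_n$ with $\mathrm{sDes}(w^{ -1})=\sigma$ and $\mathrm{finv}(w)=k$ equals the number of $w\in B_n$ with $\mathrm{sDes}(w^{ -1})=\sigma$ and $\mathrm{fmaj}(w)=k$.
   Context: $B_n$: signed permutations $w=(w(1),\dots,w(n))$ (permutations of $[n]$ with some entries barred), with $\{1,\dots,n,\bar1,\dots,\bar n\}$ totally ordered by $\bar1<_r\cdots<_r\bar n<_r1<_r\cdots<_rn$. $\mathrm{Des}(w)=\{i\in[n-1]:w(i)>_rw(i+1)\}$, $\mathrm{maj}(w)=\sum_{i\in\mathrm{Des}(w)}i$, $\mathrm{inv}(w)=|\{(i,j):1\le i<j\le n,\ w(i)>_rw(j)\}|$, $\mathrm{bar}(w)$ the number of barred entries; $\mathrm{fmaj}(w)=2\,\mathrm{maj}(w)+\mathrm{bar}(w)$ and $\mathrm{finv}(w)=2\,\mathrm{inv}(w)+\mathrm{bar}(w)$. $\Sigma^B(n)$ is the set of pairs $(S,\varepsilon)$ with $n\in S\subseteq[n]$, $\varepsilon:S\to\{\pm\}$. $\mathrm{sDes}(w)=(S,\varepsilon)$ where $S$ consists of $n$ and all $s\in[n-1]$ with $w(s)>_rw(s+1)$ or with $w(s)$ barred and $w(s+1)$ unbarred; $\varepsilon(s)=-$ if $w(s)$ is barred, $+$ otherwise. -}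

module Defs where

open import Data.Bool using (Bool; true; false; if_then_else_; _∧_; _∨_; not)
open import Data.Nat using (ℕ; zero; suc; _+_; _*_; _<ᵇ_)
open import Data.Fin using (Fin; toℕ)
open import Data.Fin.Properties using () renaming (_≟_ to _≟ᶠ_)
open import Data.Maybe using (Maybe; just; nothing)
open import Data.Product using (_×_; _,_; proj₁; proj₂)
open import Data.List using (List; []; _∷_; length; filter; concatMap; map; allFin; zip)
open import Data.Bool.ListAction using (any)
open import Data.Vec using (Vec; []; _∷_; toList; tabulate; last)
open import Relation.Nullary.Decidable using (⌊_⌋)
open import Relation.Binary.PropositionalEquality using (_≡_; refl)

-- Signed words.  A letter (v , b) with v : Fin n stands for the value
-- toℕ v + 1 ∈ [n], barred iff b ≡ true.  A signed word of length n is
-- a Vec of n letters: w = (w(1), …, w(n)).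

Letter : ℕ → Set
Letter n = Fin n × Bool

SWord : ℕ → Set
SWord n = Vec (Letter n) n

-- Key realising the total order  1̄ <_r … <_r n̄ <_r 1 <_r … <_r n :
-- barred i ↦ i-1,  unbarred i ↦ n + i - 1.
key : {n : ℕ} → Letter n → ℕ
key {n} (v , true)  = toℕ v
key {n} (v , false) = n + toℕ v

_>r_ : {n : ℕ} → Letter n → Letter n → Bool
a >r b = key b <ᵇ key a

distinct : {n : ℕ} → List (Letter n) → Bool
distinct [] = true
distinct (x ∷ xs) = not (any (λ y → ⌊ proj₁ x ≟ᶠ proj₁ y ⌋) xs) ∧ distinct xs

isSignedPerm : {n : ℕ} → SWord n → Bool
isSignedPerm w = distinct (toList w)

majFrom : {n : ℕ} → ℕ → List (Letter n) → ℕ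
majFrom p [] = 0
majFrom p (x ∷ []) = 0
majFrom p (x ∷ y ∷ ys) = (if x >r y then p else 0) + majFrom (suc p) (y ∷ ys)

maj : {n : ℕ} → SWord n → ℕ
maj w = majFrom 1 (toList w)

invL : {n : ℕ} → List (Letter n) → ℕ
invL [] = 0
invL (x ∷ xs) = length (filter (λ y → Data.Bool.T? (x >r y)) xs) + invL xs
  where import Data.Bool

inv : {n : ℕ} → SWord n → ℕ
inv w = invL (toList w)

barL : {n : ℕ} → List (Letter n) → ℕ
barL [] = 0
barL ((v , b) ∷ xs) = (if b then 1 else 0) + barL xs

bar : {n : ℕ} → SWord n → ℕ
bar w = barL (toList w)

fmaj : {n : ℕ} → SWord n → ℕ
fmaj w = 2 * maj w + bar w

finv : {n : ℕ} → SWord n → ℕ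
finv w = 2 * inv w + bar w

findPre : {n : ℕ} → Fin n → List (Fin n × Letter n) → Letter n
findPre j [] = j , false   -- never reached for signed permutations
findPre j ((i , (v , b)) ∷ rest) =
  if ⌊ v ≟ᶠ j ⌋ then (i , b) else findPre j rest

inverse : {n : ℕ} → SWord n → SWord n
inverse {n} w = tabulate (λ j → findPre j (zip (allFin n) (toList w)))

-- Signed descent sets Σ^B(n).
-- (S , ε) is encoded as σ : Vec (Maybe Sign) n, where the entry at
-- position s is nothing if s ∉ S and just (ε s) if s ∈ S.

data Sign : Set where
  plus minus : Sign

_≟s_ : (a b : Sign) → Bool
plus ≟s plus = true
minus ≟s minus = true
_ ≟s _ = false

_≟ms_ : (a b : Maybe Sign) → Bool
nothing ≟ms nothing = true
just a ≟ms just b = a ≟s b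
_ ≟ms _ = false

eqList : List (Maybe Sign) → List (Maybe Sign) → Bool
eqList [] [] = true
eqList (x ∷ xs) (y ∷ ys) = (x ≟ms y) ∧ eqList xs ys
eqList _ _ = false

-- σ ∈ Σ^B(n)  (n ≥ 1): the last position n belongs to S.
data IsJust : Maybe Sign → Set where
  isJust : (s : Sign) → IsJust (just s)

InSigmaB : {n : ℕ} → Vec (Maybe Sign) (suc n) → Set
InSigmaB σ = IsJust (last σ)

signOf : Bool → Sign
signOf true = minus
signOf false = plus

sDesL : {n : ℕ} → List (Letter n) → List (Maybe Sign)
sDesL [] = []
sDesL ((v , b) ∷ []) = just (signOf b) ∷ []
sDesL ((v , b) ∷ (u , c) ∷ rest) =
  (if ((v , b) >r (u , c)) ∨ (b ∧ not c) then just (signOf b) else nothing)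
  ∷ sDesL ((u , c) ∷ rest)

sDes : {n : ℕ} → SWord n → List (Maybe Sign)
sDes w = sDesL (toList w)

allVecs : {A : Set} → List A → (m : ℕ) → List (Vec A m)
allVecs xs zero = [] ∷ []
allVecs xs (suc m) = concatMap (λ x → map (x ∷_) (allVecs xs m)) xs

allLetters : (n : ℕ) → List (Letter n)
allLetters n = concatMap (λ v → (v , false) ∷ (v , true) ∷ []) (allFin n)

Bn : (n : ℕ) → List (SWord n)
Bn n = filter (λ w → Data.Bool.T? (isSignedPerm w)) (allVecs (allLetters n) n)
  where import Data.Bool

countB : (n : ℕ) → (SWord n → Bool) → ℕ
countB n P = length (filter (λ w → Data.Bool.T? (P w)) (Bn n))
  where import Data.Bool

module Submission where

-- A signed word is a word over the totally ordered alphabet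
-- 1̄ < … < n̄ < 1 < … < n, i.e. a list whose entries are ranked by `key`, and
-- inv and maj are the usual statistics for this order.  Foata's second
-- fundamental transformation Φ makes sense for any list ranked in ℕ; it is
-- built from the compartment rotations of module Rotation, and
--   (1) rearranges the entries of its argument and is injective (Foata);
--   (2) satisfies inv (Φ w) = maj w (FoataMajor);
--   (3) keeps the relative order of the entries of ranks a and a + 1 when
--       the ranks are distinct (FoataPairOrder).
-- By (1) Φ preserves the number of bars, so with (2) finv ∘ Φ = fmaj.
-- sDes(w⁻¹) only depends on the bar carried by each value and on the
-- relative order of the letters of consecutive values and equal bars, which
-- have consecutive ranks; by (3) it is Φ-invariant (SignedFoata).  Finally
-- Φ is an injective self-map of the duplicate-free list B_n, hence permutes
-- it by the pigeonhole principle (SignedPermutations), and the two counts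
-- agree.

open import Defs
open import Data.Bool using (Bool; true; false; if_then_else_; _∧_; _∨_; not; T)
open import Data.Bool.ListAction using (any)
open import Data.Bool.Properties using (not-involutive; not-injective; ∨-identityʳ; ∨-zeroʳ)
open import Data.Empty using (⊥-elim)
open import Data.Fin using (Fin; toℕ) renaming (zero to fzero; suc to fsuc)
open import Data.Fin.Properties using (toℕ-injective; toℕ<n) renaming (_≟_ to _≟ᶠ_)
open import Data.List using (List; []; _∷_; _++_; map; concatMap; cartesianProductWith; length; filter; reverse; last; head; zip; allFin)
open import Data.List.Membership.Propositional using (_∈_)
open import Data.List.Membership.Propositional.Properties using (∈-∃++; ∈-map⁻; ∈-allFin; ∈-filter⁺; ∈-filter⁻; ∈-cartesianProductWith⁺)
open import Data.List.Properties using (length-tabulate; length-map; length-++; filter-++; ++-assoc; ++-identityʳ; unfold-reverse; length-reverse; reverse-involutive; reverse-injective; ∷ʳ-injective)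
open import Data.List.Relation.Binary.Permutation.Propositional using (_↭_; ↭-refl; ↭-reflexive; ↭-sym; ↭-trans; ↭-prep; ↭⇒↭ₛ)
open import Data.List.Relation.Binary.Permutation.Propositional.Properties using (filter-↭; ↭-length; ++⁺ˡ; ++⁺ʳ; shift; All-resp-↭; ∈-resp-↭; ↭-reverse)
import Data.List.Relation.Binary.Permutation.Setoid.Properties as SetoidPermutation
open import Data.List.Relation.Unary.All using (All; []; _∷_) renaming (map to All-map; lookup to All-lookup)
open import Data.List.Relation.Unary.AllPairs using (AllPairs; []; _∷_) renaming (map to AllPairs-map)
open import Data.List.Relation.Unary.AllPairs.Properties using (tabulate⁺-<) renaming (map⁺ to AllPairs-map⁺)
open import Data.List.Relation.Unary.Any using (here; there)
open import Data.List.Relation.Unary.Unique.Propositional using (Unique)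
open import Data.List.Relation.Unary.Unique.Propositional.Properties using (allFin⁺; cartesianProductWith⁺) renaming (map⁺ to Unique-map⁺; filter⁺ to Unique-filter⁺)
open import Data.Maybe using (Maybe; just; nothing)
open import Data.Maybe.Relation.Unary.All using (just; nothing) renaming (All to AllMaybe)
open import Data.Nat using (ℕ; zero; suc; _+_; _*_; _<ᵇ_; _≡ᵇ_; _<_; _≤_; _≟_; _<?_; s≤s⁻¹)
open import Data.Nat.Properties using (+-comm; +-assoc; +-suc; +-identityʳ; +-commutativeSemigroup; suc-injective; +-cancelˡ-≡; m≤m+n; <-irrefl; n<1+n; <ᵇ⇒<; <⇒<ᵇ; ≮⇒≥; <⇒≱; <⇒≤; ≤∧≢⇒<; ≤-reflexive; ≤-trans; n≤1+n; ≡ᵇ⇒≡; <-≤-trans; ≤-<-trans)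
open import Algebra.Properties.CommutativeSemigroup +-commutativeSemigroup using (x∙yz≈y∙xz)
open import Data.Nat.Tactic.RingSolver using (solve-∀)
open import Data.Product using (_×_; _,_; proj₁; proj₂; Σ)
open import Data.Vec using (Vec; []; _∷_; toList; tabulate)
open import Data.Vec.Properties using (toList-injective; cast-is-id; length-toList; ∷-injective)
open import Function using (_∘_)
open import Relation.Binary.PropositionalEquality using (_≡_; _≢_; ≢-sym; setoid; resp₂; refl; sym; trans; cong; cong₂; subst; module ≡-Reasoning)
open import Relation.Nullary using (Dec; yes; no)
open import Data.Sum using (_⊎_; inj₁; inj₂)
open import Relation.Nullary.Decidable using (T?; ⌊_⌋)

false≢true : false ≢ true
false≢true ()

n≢1+n : ∀ m → m ≢ suc m
n≢1+n m eq = <-irrefl eq (n<1+n m)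

<ᵇ-true⇒< : ∀ {m n} → (m <ᵇ n) ≡ true → m < n
<ᵇ-true⇒< {m} {n} e = <ᵇ⇒< m n (subst T (sym e) _)

<ᵇ-false⇒≥ : ∀ {m n} → (m <ᵇ n) ≡ false → n ≤ m
<ᵇ-false⇒≥ e = ≮⇒≥ λ m<n → subst T e (<⇒<ᵇ m<n)

<⇒<ᵇ-true : ∀ {m n} → m < n → (m <ᵇ n) ≡ true
<⇒<ᵇ-true {m} {n} m<n with m <ᵇ n | <⇒<ᵇ m<n
... | true | _ = refl

≥⇒<ᵇ-false : ∀ {m n} → n ≤ m → (m <ᵇ n) ≡ false
≥⇒<ᵇ-false {m} {n} n≤m with m <ᵇ n in e
... | false = refl
... | true  = ⊥-elim (<⇒≱ (<ᵇ-true⇒< e) n≤m)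

≡ᵇ-true⇒≡ : ∀ {m n} → (m ≡ᵇ n) ≡ true → m ≡ n
≡ᵇ-true⇒≡ {m} {n} e = ≡ᵇ⇒≡ m n (subst T (sym e) _)

≡ᵇ-refl : ∀ m → (m ≡ᵇ m) ≡ true
≡ᵇ-refl zero    = refl
≡ᵇ-refl (suc m) = ≡ᵇ-refl m

≢⇒≡ᵇ-false : ∀ {m n} → m ≢ n → (m ≡ᵇ n) ≡ false
≢⇒≡ᵇ-false {m} {n} m≢n with m ≡ᵇ n in eq
... | false = refl
... | true  = ⊥-elim (m≢n (≡ᵇ-true⇒≡ eq))

count : ∀ {A : Set} → (A → Bool) → List A → ℕ
count p xs = length (filter (λ y → T? (p y)) xs)

count-++ : ∀ {A : Set} (p : A → Bool) xs ys → count p (xs ++ ys) ≡ count p xs + count p ys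
count-++ p xs ys = trans (cong length (filter-++ (λ y → T? (p y)) xs ys)) (length-++ (filter _ xs))

count-↭ : ∀ {A : Set} (p : A → Bool) {xs ys} → xs ↭ ys → count p xs ≡ count p ys
count-↭ p xs↭ys = ↭-length (filter-↭ (λ y → T? (p y)) xs↭ys)

count-cong : ∀ {A : Set} (p q : A → Bool) xs → (∀ {y} → y ∈ xs → p y ≡ q y) → count p xs ≡ count q xs
count-cong p q [] p≗q = refl
count-cong p q (x ∷ xs) p≗q with p x | q x | p≗q (here refl)
... | true  | .true  | refl = cong suc (count-cong p q xs (p≗q ∘ there))
... | false | .false | refl = count-cong p q xs (p≗q ∘ there)

count-all : ∀ {A : Set} (p : A → Bool) xs → All (λ y → p y ≡ true) xs → count p xs ≡ length xs
count-all p [] [] = refl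
count-all p (x ∷ xs) (px ∷ pxs) rewrite px = cong suc (count-all p xs pxs)

count-none : ∀ {A : Set} (p : A → Bool) xs → All (λ y → p y ≡ false) xs → count p xs ≡ 0
count-none p [] [] = refl
count-none p (x ∷ xs) (px ∷ pxs) rewrite px = count-none p xs pxs

count-complement : ∀ {A : Set} (p : A → Bool) xs → count p xs + count (not ∘ p) xs ≡ length xs
count-complement p [] = refl
count-complement p (x ∷ xs) with p x
... | true  = cong suc (count-complement p xs)
... | false = trans (+-suc (count p xs) _) (cong suc (count-complement p xs))

count-map : ∀ {A B : Set} (p : B → Bool) (g : A → B) xs → count p (map g xs) ≡ count (p ∘ g) xs
count-map p g [] = refl
count-map p g (x ∷ xs) with p (g x)
... | true  = cong suc (count-map p g xs)
... | false = count-map p g xs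

count-transport : ∀ {A : Set} (p : A → Bool) (g : A → A) xs → map g xs ↭ xs → count p xs ≡ count (p ∘ g) xs
count-transport p g xs g-permutes = trans (sym (count-↭ p g-permutes)) (count-map p g xs)

AllPairs-resp-↭ : ∀ {A : Set} {R : A → A → Set} → (∀ {x y} → R x y → R y x) →
                  ∀ {xs ys} → xs ↭ ys → AllPairs R xs → AllPairs R ys
AllPairs-resp-↭ {A} {R} R-sym xs↭ys =
  SetoidPermutation.AllPairs-resp-↭ (setoid A) R-sym (resp₂ R) (↭⇒↭ₛ xs↭ys)

unique-⊆-↭ : ∀ {A : Set} (xs ys : List A) → Unique xs → Unique ys → (∀ {x} → x ∈ xs → x ∈ ys) →
             length ys ≤ length xs → xs ↭ ys
unique-⊆-↭ [] [] _ _ _ _ = ↭-refl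
unique-⊆-↭ (x ∷ xs) ys (x∉xs ∷ unique-xs) unique-ys xs⊆ys len with ∈-∃++ (xs⊆ys (here refl))
... | us , vs , refl =
  ↭-trans (↭-prep x (unique-⊆-↭ xs (us ++ vs) unique-xs unique-us++vs xs⊆us++vs len′)) (↭-sym moved)
  where
  moved : us ++ x ∷ vs ↭ x ∷ (us ++ vs)
  moved = shift x us vs
  unique-us++vs : Unique (us ++ vs)
  unique-us++vs with AllPairs-resp-↭ ≢-sym moved unique-ys
  ... | _ ∷ unique = unique
  xs⊆us++vs : ∀ {z} → z ∈ xs → z ∈ us ++ vs
  xs⊆us++vs z∈xs with ∈-resp-↭ moved (xs⊆ys (there z∈xs))
  ... | here refl = ⊥-elim (All-lookup x∉xs z∈xs refl)
  ... | there z∈  = z∈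
  len′ : length (us ++ vs) ≤ length xs
  len′ = s≤s⁻¹ (subst (_≤ suc (length xs)) (↭-length moved) len)

module Inversions {A : Set} (rank : A → ℕ) where

  _≻_ : A → A → Bool
  a ≻ b = rank b <ᵇ rank a

  above-beats-below : ∀ {x y b} → y ≻ x ≡ true → b ≻ x ≡ false →
                      (y ≻ b ≡ true) × (b ≻ y ≡ false)
  above-beats-below {x} {y} {b} y≻x b⊁x = <⇒<ᵇ-true b<y , ≥⇒<ᵇ-false (<⇒≤ b<y)
    where
    b<y : rank b < rank y
    b<y = ≤-<-trans (<ᵇ-false⇒≥ {rank x} b⊁x) (<ᵇ-true⇒< y≻x)

  inversions : List A → ℕ
  inversions [] = 0
  inversions (x ∷ xs) = count (x ≻_) xs + inversions xs

  crossings : List A → List A → ℕ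
  crossings [] ys = 0
  crossings (x ∷ xs) ys = count (x ≻_) ys + crossings xs ys

  crossings-↭ : ∀ xs {ys zs} → ys ↭ zs → crossings xs ys ≡ crossings xs zs
  crossings-↭ [] ys↭zs = refl
  crossings-↭ (x ∷ xs) ys↭zs = cong₂ _+_ (count-↭ (x ≻_) ys↭zs) (crossings-↭ xs ys↭zs)

  crossings-[] : ∀ xs → crossings xs [] ≡ 0
  crossings-[] [] = refl
  crossings-[] (x ∷ xs) = crossings-[] xs

  crossings-∷ : ∀ xs z ys → crossings xs (z ∷ ys) ≡ count (_≻ z) xs + crossings xs ys
  crossings-∷ [] z ys = refl
  crossings-∷ (x ∷ xs) z ys with x ≻ z
  ... | true  = cong suc (trans (cong (count (x ≻_) ys +_) (crossings-∷ xs z ys))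
                                (x∙yz≈y∙xz (count (x ≻_) ys) (count (_≻ z) xs) (crossings xs ys)))
  ... | false = trans (cong (count (x ≻_) ys +_) (crossings-∷ xs z ys))
                      (x∙yz≈y∙xz (count (x ≻_) ys) (count (_≻ z) xs) (crossings xs ys))

  inversions-++ : ∀ xs ys → inversions (xs ++ ys) ≡ inversions xs + inversions ys + crossings xs ys
  inversions-++ [] ys = sym (+-identityʳ (inversions ys))
  inversions-++ (x ∷ xs) ys rewrite count-++ (x ≻_) xs ys | inversions-++ xs ys =
    regroup (count (x ≻_) xs) (count (x ≻_) ys) (inversions xs) (inversions ys) (crossings xs ys)
    where
    regroup : ∀ a b c d e → a + b + (c + d + e) ≡ a + c + d + (b + e)
    regroup = solve-∀

  inversions-∷ʳ : ∀ xs x → inversions (xs ++ x ∷ []) ≡ inversions xs + count (_≻ x) xs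
  inversions-∷ʳ xs x
    rewrite inversions-++ xs (x ∷ []) | crossings-∷ xs x [] | crossings-[] xs
          | +-identityʳ (inversions xs) | +-identityʳ (count (_≻ x) xs) = refl

  majorFrom : ℕ → List A → ℕ
  majorFrom p [] = 0
  majorFrom p (x ∷ []) = 0
  majorFrom p (x ∷ y ∷ ys) = (if x ≻ y then p else 0) + majorFrom (suc p) (y ∷ ys)

  majorFrom-∷ʳ : ∀ p M y x → majorFrom p (M ++ y ∷ x ∷ [])
                               ≡ majorFrom p (M ++ y ∷ []) + (if y ≻ x then p + length M else 0)
  majorFrom-∷ʳ p [] y x with y ≻ x
  ... | true  = refl
  ... | false = refl
  majorFrom-∷ʳ p (z ∷ []) y x = begin
    d + majorFrom (suc p) (y ∷ x ∷ [])                 ≡⟨ cong (d +_) (majorFrom-∷ʳ (suc p) [] y x) ⟩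
    d + (0 + (if y ≻ x then suc p + 0 else 0))         ≡⟨ sym (+-assoc d 0 _) ⟩
    d + 0 + (if y ≻ x then suc p + 0 else 0)           ≡⟨ cong (λ t → d + 0 + (if y ≻ x then t else 0)) (sym (+-suc p 0)) ⟩
    d + 0 + (if y ≻ x then p + 1 else 0)               ∎
    where
    open ≡-Reasoning
    d : ℕ
    d = if z ≻ y then p else 0
  majorFrom-∷ʳ p (z ∷ w ∷ M) y x = begin
    d + majorFrom (suc p) (w ∷ M ++ y ∷ x ∷ [])
      ≡⟨ cong (d +_) (majorFrom-∷ʳ (suc p) (w ∷ M) y x) ⟩
    d + (majorFrom (suc p) (w ∷ M ++ y ∷ []) + (if y ≻ x then suc p + length (w ∷ M) else 0))
      ≡⟨ sym (+-assoc d _ _) ⟩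
    majorFrom p (z ∷ w ∷ M ++ y ∷ []) + (if y ≻ x then suc p + length (w ∷ M) else 0)
      ≡⟨ cong (λ t → majorFrom p (z ∷ w ∷ M ++ y ∷ []) + (if y ≻ x then t else 0)) (sym (+-suc p (length (w ∷ M)))) ⟩
    majorFrom p (z ∷ w ∷ M ++ y ∷ []) + (if y ≻ x then p + length (z ∷ w ∷ M) else 0) ∎
    where
    open ≡-Reasoning
    d : ℕ
    d = if z ≻ w then p else 0

module Rotation {A : Set} where

  Failing : (A → Bool) → List A → Set
  Failing p = All (λ z → p z ≡ false)

  -- Reading ys from left to right, the entries failing p are kept in a pending
  -- block blk; an entry y passing p closes the compartment blk y, which is
  -- output as y blk.
  rotate : (A → Bool) → List A → List A → List A
  rotate p blk [] = blk
  rotate p blk (y ∷ ys) =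
    if p y then y ∷ (blk ++ rotate p [] ys) else rotate p (blk ++ y ∷ []) ys

  rotate-↭ : ∀ p blk ys → rotate p blk ys ↭ blk ++ ys
  rotate-↭ p blk [] rewrite ++-identityʳ blk = ↭-refl
  rotate-↭ p blk (y ∷ ys) with p y
  ... | true  = ↭-trans (↭-prep y (++⁺ˡ blk (rotate-↭ p [] ys))) (↭-sym (shift y blk ys))
  ... | false rewrite sym (++-assoc blk (y ∷ []) ys) = rotate-↭ p (blk ++ y ∷ []) ys

  -- γ is empty or its last entry passes p: then rotate p leaves no pending block
  EndsAtCut : (A → Bool) → List A → Set
  EndsAtCut p γ = AllMaybe (λ z → p z ≡ true) (last γ)

  last-++ : ∀ (xs : List A) z ys → last (xs ++ z ∷ ys) ≡ last (z ∷ ys)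
  last-++ [] z ys = refl
  last-++ (x ∷ []) z ys = refl
  last-++ (x ∷ x′ ∷ xs) z ys = last-++ (x′ ∷ xs) z ys

  endsAtCut-suffix : ∀ p xs z ys → EndsAtCut p (xs ++ z ∷ ys) → EndsAtCut p (z ∷ ys)
  endsAtCut-suffix p xs z ys = subst (AllMaybe (λ z → p z ≡ true)) (last-++ xs z ys)

  endsAtCut-tail : ∀ p z ys → EndsAtCut p (z ∷ ys) → EndsAtCut p ys
  endsAtCut-tail p z [] _ = nothing
  endsAtCut-tail p z (y ∷ ys) ends = ends

  endsAtCut-shift : ∀ p blk z ys → EndsAtCut p (blk ++ z ∷ ys) → EndsAtCut p ((blk ++ z ∷ []) ++ ys)
  endsAtCut-shift p blk z ys = subst (EndsAtCut p) (sym (++-assoc blk (z ∷ []) ys))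

  endsAtCut-rest : ∀ p blk z ys → EndsAtCut p (blk ++ z ∷ ys) → EndsAtCut p ys
  endsAtCut-rest p blk z ys ends = endsAtCut-tail p z ys (endsAtCut-suffix p blk z ys ends)

  failing-endsAtCut : ∀ p blk → Failing p blk → EndsAtCut p (blk ++ []) → blk ≡ []
  failing-endsAtCut p [] _ _ = refl
  failing-endsAtCut p (b ∷ []) (b✗ ∷ []) (just b✓) = ⊥-elim (false≢true (trans (sym b✗) b✓))
  failing-endsAtCut p (b ∷ b′ ∷ bs) (_ ∷ fails) ends with failing-endsAtCut p (b′ ∷ bs) fails ends
  ... | ()

  failing-∷ʳ : ∀ p blk y → Failing p blk → p y ≡ false → Failing p (blk ++ y ∷ [])
  failing-∷ʳ p [] y [] y✗ = y✗ ∷ []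
  failing-∷ʳ p (b ∷ blk) y (b✗ ∷ fails) y✗ = b✗ ∷ failing-∷ʳ p blk y fails y✗

  -- Undoing rotate: each segment y b₁…b_k, where y passes p and the b's fail,
  -- becomes b₁…b_k y again (acc holds the b's read so far).
  unrotateFrom : (A → Bool) → A → List A → List A → List A
  unrotateFrom p y acc [] = acc ++ y ∷ []
  unrotateFrom p y acc (z ∷ zs) =
    if p z then acc ++ y ∷ unrotateFrom p z [] zs else unrotateFrom p y (acc ++ z ∷ []) zs

  unrotate : (A → Bool) → List A → List A
  unrotate p [] = []
  unrotate p (y ∷ ys) = unrotateFrom p y [] ys

  unrotateFrom-failing : ∀ p y acc blk zs → Failing p blk →
    unrotateFrom p y acc (blk ++ zs) ≡ unrotateFrom p y (acc ++ blk) zs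
  unrotateFrom-failing p y acc [] zs [] rewrite ++-identityʳ acc = refl
  unrotateFrom-failing p y acc (b ∷ blk) zs (b✗ ∷ fails) rewrite b✗ =
    trans (unrotateFrom-failing p y (acc ++ b ∷ []) blk zs fails)
          (cong (λ t → unrotateFrom p y t zs) (++-assoc acc (b ∷ []) blk))

  unrotateFrom-rotate : ∀ p y acc blk ys → Failing p blk → EndsAtCut p (blk ++ ys) →
    unrotateFrom p y acc (rotate p blk ys) ≡ acc ++ y ∷ blk ++ ys
  unrotateFrom-rotate p y acc blk [] fails ends with failing-endsAtCut p blk fails ends
  ... | refl = refl
  unrotateFrom-rotate p y acc blk (z ∷ ys) fails ends with p z in z✓
  ... | true rewrite z✓ = begin
      acc ++ y ∷ unrotateFrom p z [] (blk ++ rotate p [] ys)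
        ≡⟨ cong (λ t → acc ++ y ∷ t) (unrotateFrom-failing p z [] blk _ fails) ⟩
      acc ++ y ∷ unrotateFrom p z blk (rotate p [] ys)
        ≡⟨ cong (λ t → acc ++ y ∷ t) (unrotateFrom-rotate p z blk [] ys [] (endsAtCut-rest p blk z ys ends)) ⟩
      acc ++ y ∷ blk ++ z ∷ ys ∎
    where open ≡-Reasoning
  ... | false = trans
      (unrotateFrom-rotate p y acc (blk ++ z ∷ []) ys (failing-∷ʳ p blk z fails z✓) (endsAtCut-shift p blk z ys ends))
      (cong (λ t → acc ++ y ∷ t) (++-assoc blk (z ∷ []) ys))

  unrotate-rotate : ∀ p blk ys → Failing p blk → EndsAtCut p (blk ++ ys) →
    unrotate p (rotate p blk ys) ≡ blk ++ ys
  unrotate-rotate p blk [] fails ends with failing-endsAtCut p blk fails ends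
  ... | refl = refl
  unrotate-rotate p blk (z ∷ ys) fails ends with p z in z✓
  ... | true = trans (unrotateFrom-failing p z [] blk _ fails)
      (unrotateFrom-rotate p z blk [] ys [] (endsAtCut-rest p blk z ys ends))
  ... | false = trans
      (unrotate-rotate p (blk ++ z ∷ []) ys (failing-∷ʳ p blk z fails z✓) (endsAtCut-shift p blk z ys ends))
      (++-assoc blk (z ∷ []) ys)

  StartsAtCut : (A → Bool) → List A → Set
  StartsAtCut p γ = AllMaybe (λ z → p z ≡ true) (head γ)

  rotate-startsAtCut : ∀ p blk ys → Failing p blk → EndsAtCut p (blk ++ ys) →
    StartsAtCut p (rotate p blk ys)
  rotate-startsAtCut p blk [] fails ends with failing-endsAtCut p blk fails ends
  ... | refl = nothing
  rotate-startsAtCut p blk (z ∷ ys) fails ends with p z in z✓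
  ... | true  = just z✓
  ... | false = rotate-startsAtCut p (blk ++ z ∷ []) ys (failing-∷ʳ p blk z fails z✓) (endsAtCut-shift p blk z ys ends)

  filter-failing : ∀ (q p : A → Bool) blk → Failing p blk → (∀ y → q y ≡ true → p y ≡ true) →
    filter (λ y → T? (q y)) blk ≡ []
  filter-failing q p [] [] q⇒p = refl
  filter-failing q p (b ∷ blk) (b✗ ∷ fails) q⇒p with q b in bq
  ... | true  = ⊥-elim (false≢true (trans (sym b✗) (q⇒p b bq)))
  ... | false = filter-failing q p blk fails q⇒p

  -- rotate moves passing entries only past failing ones, so it keeps the
  -- subsequence picked out by a test q that never picks entries of both kinds
  rotate-filter : ∀ (q p : A → Bool) c blk ys → Failing p blk → (∀ y → q y ≡ true → p y ≡ c) →
    filter (λ y → T? (q y)) (rotate p blk ys) ≡ filter (λ y → T? (q y)) (blk ++ ys)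
  rotate-filter q p c blk [] fails q⇒c rewrite ++-identityʳ blk = refl
  rotate-filter q p c blk (y ∷ ys) fails q⇒c with p y in y✓ | q y in yq
  ... | false | _ = trans (rotate-filter q p c (blk ++ y ∷ []) ys (failing-∷ʳ p blk y fails y✓) q⇒c)
                          (cong (filter (λ y → T? (q y))) (++-assoc blk (y ∷ []) ys))
  ... | true | false
    rewrite yq | filter-++ (λ y → T? (q y)) blk (rotate p [] ys) | filter-++ (λ y → T? (q y)) blk (y ∷ ys)
          | yq | rotate-filter q p c [] ys [] q⇒c = refl
  ... | true | true with trans (sym (q⇒c y yq)) y✓
  ...   | refl
    rewrite yq | filter-++ (λ y → T? (q y)) blk (rotate p [] ys) | filter-++ (λ y → T? (q y)) blk (y ∷ ys)
          | yq | rotate-filter q p true [] ys [] q⇒c | filter-failing q p blk fails q⇒c = refl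

module Foata {A : Set} (rank : A → ℕ) where
  open Inversions rank
  open Rotation

  -- When the letter x is inserted after γ, the compartments of γ end at the
  -- entries above x if the last entry of γ is above x, at the other entries
  -- otherwise.
  cut : Bool → A → A → Bool
  cut true  x y = y ≻ x
  cut false x y = not (y ≻ x)

  endsAbove : A → Maybe A → Bool
  endsAbove x nothing  = true
  endsAbove x (just z) = z ≻ x

  cutFor : A → List A → A → Bool
  cutFor x γ = cut (endsAbove x (last γ)) x

  foataRotation : A → List A → List A
  foataRotation x γ = rotate (cutFor x γ) [] γ

  foataStep : A → List A → List A
  foataStep x γ = foataRotation x γ ++ x ∷ []

  -- Foata's map of the reversal of rs: the letters are inserted from the last
  -- one of rs back to the first one.
  foataRev : List A → List A
  foataRev [] = []
  foataRev (x ∷ rs) = foataStep x (foataRev rs)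

  foata : List A → List A
  foata w = foataRev (reverse w)

  foataRev-↭ : ∀ rs → foataRev rs ↭ reverse rs
  foataRev-↭ [] = ↭-refl
  foataRev-↭ (x ∷ rs) rewrite unfold-reverse x rs =
    ++⁺ʳ (x ∷ []) (↭-trans (rotate-↭ _ [] (foataRev rs)) (foataRev-↭ rs))

  foata-↭ : ∀ w → foata w ↭ w
  foata-↭ w = ↭-trans (foataRev-↭ (reverse w)) (↭-reflexive (reverse-involutive w))

  foataRev-length : ∀ rs → length (foataRev rs) ≡ length rs
  foataRev-length rs = trans (↭-length (foataRev-↭ rs)) (length-reverse rs)

  foata-length : ∀ w → length (foata w) ≡ length w
  foata-length w = ↭-length (foata-↭ w)

  cut-self : ∀ x z → cut (z ≻ x) x z ≡ true
  cut-self x z with z ≻ x in z≻x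
  ... | true  = z≻x
  ... | false rewrite z≻x = refl

  cutFor-endsAtCut : ∀ x γ → EndsAtCut (cutFor x γ) γ
  cutFor-endsAtCut x γ with last γ
  ... | nothing = nothing
  ... | just z  = just (cut-self x z)

  cut-unique : ∀ c c′ x z → cut c x z ≡ true → cut c′ x z ≡ true → c ≡ c′
  cut-unique true  true  x z _ _ = refl
  cut-unique false false x z _ _ = refl
  cut-unique true  false x z z≻x z⊁x = ⊥-elim (false≢true (trans (sym (cong not z≻x)) z⊁x))
  cut-unique false true  x z z⊁x z≻x = ⊥-elim (false≢true (trans (sym (cong not z≻x)) z⊁x))

  -- the first entry of a rotated word tells which cut test was used
  unrotate-cut : ∀ x c c′ G → StartsAtCut (cut c x) G → StartsAtCut (cut c′ x) G →
    unrotate (cut c x) G ≡ unrotate (cut c′ x) G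
  unrotate-cut x c c′ [] _ _ = refl
  unrotate-cut x c c′ (z ∷ zs) (just z✓) (just z✓′) with cut-unique c c′ x z z✓ z✓′
  ... | refl = refl

  rotate-injective : ∀ x c c′ γ δ → EndsAtCut (cut c x) γ → EndsAtCut (cut c′ x) δ →
    rotate (cut c x) [] γ ≡ rotate (cut c′ x) [] δ → γ ≡ δ
  rotate-injective x c c′ γ δ γ-ends δ-ends eq = begin
    γ                                             ≡⟨ sym (unrotate-rotate (cut c x) [] γ [] γ-ends) ⟩
    unrotate (cut c x) (rotate (cut c x) [] γ)    ≡⟨ cong (unrotate (cut c x)) eq ⟩
    unrotate (cut c x) (rotate (cut c′ x) [] δ)   ≡⟨ unrotate-cut x c c′ _ starts (rotate-startsAtCut _ [] δ [] δ-ends) ⟩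
    unrotate (cut c′ x) (rotate (cut c′ x) [] δ)  ≡⟨ unrotate-rotate (cut c′ x) [] δ [] δ-ends ⟩
    δ                                             ∎
    where
    open ≡-Reasoning
    starts : StartsAtCut (cut c x) (rotate (cut c′ x) [] δ)
    starts = subst (StartsAtCut (cut c x)) eq (rotate-startsAtCut _ [] γ [] γ-ends)

  foataRev-injective : ∀ rs ss → foataRev rs ≡ foataRev ss → rs ≡ ss
  foataRev-injective [] [] eq = refl
  foataRev-injective [] (x ∷ ss) eq with trans (cong length eq) (foataRev-length (x ∷ ss))
  ... | ()
  foataRev-injective (x ∷ rs) [] eq with trans (cong length (sym eq)) (foataRev-length (x ∷ rs))
  ... | ()
  foataRev-injective (x ∷ rs) (y ∷ ss) eq with ∷ʳ-injective _ _ eq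
  ... | rotated-eq , refl = cong (x ∷_) (foataRev-injective rs ss
        (rotate-injective x (endsAbove x (last γ)) (endsAbove x (last δ)) γ δ
          (cutFor-endsAtCut x γ) (cutFor-endsAtCut x δ) rotated-eq))
    where
    γ δ : List A
    γ = foataRev rs
    δ = foataRev ss

  foata-injective : ∀ w w′ → foata w ≡ foata w′ → w ≡ w′
  foata-injective w w′ eq = reverse-injective (foataRev-injective (reverse w) (reverse w′) eq)

module FoataMajor {A : Set} (rank : A → ℕ) where
  open Inversions rank
  open Rotation
  open Foata rank

  -- The sum, over the compartments blk′ y closed by rotate, of the number of
  -- b ∈ blk′ with q y b.
  compartmentPairs : (A → A → Bool) → (A → Bool) → List A → List A → ℕ
  compartmentPairs q p blk [] = 0
  compartmentPairs q p blk (y ∷ ys) =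
    if p y then count (q y) blk + compartmentPairs q p [] ys
    else compartmentPairs q p (blk ++ y ∷ []) ys

  -- Turning blk′ y into y blk′ creates the inversions (y , b) and destroys the
  -- inversions (b , y), for b ∈ blk′; all other pairs keep their order.
  rotate-inversions : ∀ p blk ys →
    inversions (rotate p blk ys) + compartmentPairs (λ y b → b ≻ y) p blk ys
      ≡ inversions (blk ++ ys) + compartmentPairs _≻_ p blk ys
  rotate-inversions p blk [] rewrite ++-identityʳ blk = refl
  rotate-inversions p blk (y ∷ ys) with p y
  ... | false rewrite sym (++-assoc blk (y ∷ []) ys) = rotate-inversions p (blk ++ y ∷ []) ys
  ... | true
    rewrite count-++ (y ≻_) blk (rotate p [] ys)
          | inversions-++ blk (rotate p [] ys)
          | count-↭ (y ≻_) (rotate-↭ p [] ys)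
          | crossings-↭ blk (rotate-↭ p [] ys)
          | inversions-++ blk (y ∷ ys)
          | crossings-∷ blk y ys
    = regroup (count (y ≻_) blk) (count (y ≻_) ys) (inversions blk) (crossings blk ys)
              (count (_≻ y) blk) (inversions ys) _ _ (rotate-inversions p [] ys)
    where
    regroup : ∀ a b c d e f g h {i} → i + g ≡ f + h →
      a + b + (c + i + d) + (e + g) ≡ c + (b + f) + (e + d) + (a + h)
    regroup a b c d e f g h {i} eq = begin
      a + b + (c + i + d) + (e + g)   ≡⟨ collect a b c d e i g ⟩
      (a + b + c + d + e) + (i + g)   ≡⟨ cong ((a + b + c + d + e) +_) eq ⟩
      (a + b + c + d + e) + (f + h)   ≡⟨ spread a b c d e f h ⟩
      c + (b + f) + (e + d) + (a + h) ∎
      where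
      open ≡-Reasoning
      collect : ∀ a b c d e i g → a + b + (c + i + d) + (e + g) ≡ (a + b + c + d + e) + (i + g)
      collect = solve-∀
      spread : ∀ a b c d e f h → (a + b + c + d + e) + (f + h) ≡ c + (b + f) + (e + d) + (a + h)
      spread = solve-∀

  compartmentPairs-all : ∀ q p blk ys → Failing p blk → EndsAtCut p (blk ++ ys) →
    (∀ {y b} → p y ≡ true → p b ≡ false → q y b ≡ true) →
    compartmentPairs q p blk ys ≡ length blk + count (not ∘ p) ys
  compartmentPairs-all q p blk [] fails ends q✓ with failing-endsAtCut p blk fails ends
  ... | refl = refl
  compartmentPairs-all q p blk (y ∷ ys) fails ends q✓ with p y in y✓
  ... | true = cong₂ _+_ (count-all (q y) blk (All-map (q✓ y✓) fails))
                         (compartmentPairs-all q p [] ys [] (endsAtCut-rest p blk y ys ends) q✓)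
  ... | false = begin
    compartmentPairs q p (blk ++ y ∷ []) ys
      ≡⟨ compartmentPairs-all q p (blk ++ y ∷ []) ys (failing-∷ʳ p blk y fails y✓) (endsAtCut-shift p blk y ys ends) q✓ ⟩
    length (blk ++ y ∷ []) + count (not ∘ p) ys
      ≡⟨ cong (_+ count (not ∘ p) ys) (trans (length-++ blk) (+-comm (length blk) 1)) ⟩
    suc (length blk) + count (not ∘ p) ys
      ≡⟨ sym (+-suc (length blk) _) ⟩
    length blk + suc (count (not ∘ p) ys) ∎
    where open ≡-Reasoning

  compartmentPairs-none : ∀ q p blk ys → Failing p blk →
    (∀ {y b} → p y ≡ true → p b ≡ false → q y b ≡ false) →
    compartmentPairs q p blk ys ≡ 0
  compartmentPairs-none q p blk [] fails q✗ = refl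
  compartmentPairs-none q p blk (y ∷ ys) fails q✗ with p y in y✓
  ... | true = cong₂ _+_ (count-none (q y) blk (All-map (q✗ y✓) fails)) (compartmentPairs-none q p [] ys [] q✗)
  ... | false = compartmentPairs-none q p (blk ++ y ∷ []) ys (failing-∷ʳ p blk y fails y✓) q✗

  -- Cut at the entries above x: each compartment b₁…b_k y, with y above x and
  -- the b's not, becomes y b₁…b_k and gains one inversion per entry not above
  -- x; appending x adds one per entry above x.
  step-inversions-above : ∀ x γ → EndsAtCut (cut true x) γ →
    inversions (rotate (cut true x) [] γ ++ x ∷ []) ≡ inversions γ + length γ
  step-inversions-above x γ ends = begin
    inversions (G ++ x ∷ [])
      ≡⟨ inversions-∷ʳ G x ⟩
    inversions G + count (_≻ x) G
      ≡⟨ cong₂ _+_ G-inversions (count-↭ (_≻ x) (rotate-↭ _ [] γ)) ⟩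
    inversions γ + count below γ + count (_≻ x) γ
      ≡⟨ +-assoc (inversions γ) _ _ ⟩
    inversions γ + (count below γ + count (_≻ x) γ)
      ≡⟨ cong (inversions γ +_) (trans (+-comm (count below γ) _) (count-complement (_≻ x) γ)) ⟩
    inversions γ + length γ ∎
    where
    open ≡-Reasoning
    G : List A
    G = rotate (cut true x) [] γ
    below : A → Bool
    below = not ∘ cut true x
    G-inversions : inversions G ≡ inversions γ + count below γ
    G-inversions = begin
      inversions G
        ≡⟨ sym (+-identityʳ _) ⟩
      inversions G + 0
        ≡⟨ cong (inversions G +_) (sym (compartmentPairs-none _ (cut true x) [] γ []
             (λ y✓ b✗ → proj₂ (above-beats-below y✓ b✗)))) ⟩
      inversions G + compartmentPairs (λ y b → b ≻ y) (cut true x) [] γ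
        ≡⟨ rotate-inversions (cut true x) [] γ ⟩
      inversions γ + compartmentPairs _≻_ (cut true x) [] γ
        ≡⟨ cong (inversions γ +_) (compartmentPairs-all _≻_ (cut true x) [] γ [] ends
             (λ y✓ b✗ → proj₁ (above-beats-below y✓ b✗))) ⟩
      inversions γ + count below γ ∎

  -- Cut at the entries not above x: each compartment b₁…b_k y, with the b's
  -- above x and y not, becomes y b₁…b_k and loses one inversion per entry
  -- above x, which appending x restores.
  step-inversions-below : ∀ x γ → EndsAtCut (cut false x) γ →
    inversions (rotate (cut false x) [] γ ++ x ∷ []) ≡ inversions γ + 0
  step-inversions-below x γ ends = begin
    inversions (G ++ x ∷ [])
      ≡⟨ inversions-∷ʳ G x ⟩
    inversions G + count (_≻ x) G
      ≡⟨ cong (inversions G +_) (count-↭ (_≻ x) (rotate-↭ _ [] γ)) ⟩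
    inversions G + count (_≻ x) γ
      ≡⟨ cong (inversions G +_) (count-cong _ _ γ (λ {z} _ → sym (not-involutive (z ≻ x)))) ⟩
    inversions G + count (not ∘ cut false x) γ
      ≡⟨ cong (inversions G +_) (sym (compartmentPairs-all _ (cut false x) [] γ [] ends
           (λ y✓ b✗ → proj₁ (separated y✓ b✗)))) ⟩
    inversions G + compartmentPairs (λ y b → b ≻ y) (cut false x) [] γ
      ≡⟨ rotate-inversions (cut false x) [] γ ⟩
    inversions γ + compartmentPairs _≻_ (cut false x) [] γ
      ≡⟨ cong (inversions γ +_) (compartmentPairs-none _≻_ (cut false x) [] γ []
           (λ y✓ b✗ → proj₂ (separated y✓ b✗))) ⟩
    inversions γ + 0 ∎
    where
    open ≡-Reasoning
    G : List A
    G = rotate (cut false x) [] γ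
    separated : ∀ {y b} → not (y ≻ x) ≡ true → not (b ≻ x) ≡ false → (b ≻ y ≡ true) × (y ≻ b ≡ false)
    separated {y} {b} y✓ b✗ = above-beats-below (not-injective {b ≻ x} {true} b✗) (not-injective {y ≻ x} {false} y✓)

  step-inversions : ∀ c x γ → EndsAtCut (cut c x) γ →
    inversions (rotate (cut c x) [] γ ++ x ∷ []) ≡ inversions γ + (if c then length γ else 0)
  step-inversions true  = step-inversions-above
  step-inversions false = step-inversions-below

  last-foataRev : ∀ y rs → last (foataRev (y ∷ rs)) ≡ just y
  last-foataRev y rs = last-++ (foataRotation y (foataRev rs)) y []

  reverse-∷∷ : ∀ (x y : A) rs → reverse (x ∷ y ∷ rs) ≡ reverse rs ++ y ∷ x ∷ []
  reverse-∷∷ x y rs = begin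
    reverse (x ∷ y ∷ rs)               ≡⟨ unfold-reverse x (y ∷ rs) ⟩
    reverse (y ∷ rs) ++ x ∷ []         ≡⟨ cong (_++ x ∷ []) (unfold-reverse y rs) ⟩
    (reverse rs ++ y ∷ []) ++ x ∷ []   ≡⟨ ++-assoc (reverse rs) (y ∷ []) (x ∷ []) ⟩
    reverse rs ++ y ∷ x ∷ []           ∎
    where open ≡-Reasoning

  foataRev-inversions : ∀ rs → inversions (foataRev rs) ≡ majorFrom 1 (reverse rs)
  foataRev-inversions [] = refl
  foataRev-inversions (x ∷ []) = refl
  foataRev-inversions (x ∷ y ∷ rs) = begin
    inversions (foataStep x γ)
      ≡⟨ step-inversions (endsAbove x (last γ)) x γ (cutFor-endsAtCut x γ) ⟩
    inversions γ + (if endsAbove x (last γ) then length γ else 0)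
      ≡⟨ cong₂ (λ i z → i + (if endsAbove x z then length γ else 0)) (foataRev-inversions (y ∷ rs)) (last-foataRev y rs) ⟩
    majorFrom 1 (reverse (y ∷ rs)) + (if y ≻ x then length γ else 0)
      ≡⟨ cong₂ (λ M l → majorFrom 1 M + (if y ≻ x then l else 0)) (unfold-reverse y rs) length-γ ⟩
    majorFrom 1 (reverse rs ++ y ∷ []) + (if y ≻ x then 1 + length (reverse rs) else 0)
      ≡⟨ sym (majorFrom-∷ʳ 1 (reverse rs) y x) ⟩
    majorFrom 1 (reverse rs ++ y ∷ x ∷ [])
      ≡⟨ cong (majorFrom 1) (sym (reverse-∷∷ x y rs)) ⟩
    majorFrom 1 (reverse (x ∷ y ∷ rs)) ∎
    where
    open ≡-Reasoning
    γ : List A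
    γ = foataRev (y ∷ rs)
    length-γ : length γ ≡ 1 + length (reverse rs)
    length-γ = trans (foataRev-length (y ∷ rs)) (cong suc (sym (length-reverse rs)))

  foata-inversions : ∀ w → inversions (foata w) ≡ majorFrom 1 w
  foata-inversions w = trans (foataRev-inversions (reverse w)) (cong (majorFrom 1) (reverse-involutive w))

module FoataPairOrder {A : Set} (rank : A → ℕ) where
  open Inversions rank
  open Rotation
  open Foata rank

  DistinctRanks : List A → Set
  DistinctRanks = AllPairs (λ u v → rank u ≢ rank v)

  lowerFirst : ℕ → List A → Bool
  lowerFirst a [] = false
  lowerFirst a (y ∷ L) = if rank y ≡ᵇ a then true else (if rank y ≡ᵇ suc a then false else lowerFirst a L)

  inPair : ℕ → A → Bool
  inPair a y = (rank y ≡ᵇ a) ∨ (rank y ≡ᵇ suc a)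

  lowerFirst-filter : ∀ a L → lowerFirst a (filter (λ y → T? (inPair a y)) L) ≡ lowerFirst a L
  lowerFirst-filter a [] = refl
  lowerFirst-filter a (y ∷ L) with rank y ≡ᵇ a in lower | rank y ≡ᵇ suc a in upper
  ... | true  | _     rewrite lower = refl
  ... | false | true  rewrite lower | upper = refl
  ... | false | false = lowerFirst-filter a L

  lowerFirst-∷ʳ : ∀ a M x → lowerFirst a (M ++ x ∷ [])
                    ≡ (if count (inPair a) M ≡ᵇ 0 then lowerFirst a (x ∷ []) else lowerFirst a M)
  lowerFirst-∷ʳ a [] x = refl
  lowerFirst-∷ʳ a (y ∷ M) x with rank y ≡ᵇ a | rank y ≡ᵇ suc a
  ... | true  | _     = refl
  ... | false | true  = refl
  ... | false | false = lowerFirst-∷ʳ a M x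

  lowerFirst-∷ʳ-cong : ∀ a M N x → M ↭ N → lowerFirst a M ≡ lowerFirst a N →
                       lowerFirst a (M ++ x ∷ []) ≡ lowerFirst a (N ++ x ∷ [])
  lowerFirst-∷ʳ-cong a M N x M↭N same = begin
    lowerFirst a (M ++ x ∷ [])
      ≡⟨ lowerFirst-∷ʳ a M x ⟩
    (if count (inPair a) M ≡ᵇ 0 then lowerFirst a (x ∷ []) else lowerFirst a M)
      ≡⟨ cong₂ (λ k l → if k ≡ᵇ 0 then lowerFirst a (x ∷ []) else l) (count-↭ (inPair a) M↭N) same ⟩
    (if count (inPair a) N ≡ᵇ 0 then lowerFirst a (x ∷ []) else lowerFirst a N)
      ≡⟨ sym (lowerFirst-∷ʳ a N x) ⟩
    lowerFirst a (N ++ x ∷ []) ∎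
    where open ≡-Reasoning

  lowerFirst-no-lower : ∀ a M → All (λ y → rank y ≢ a) M → lowerFirst a M ≡ false
  lowerFirst-no-lower a [] [] = refl
  lowerFirst-no-lower a (y ∷ M) (y≢a ∷ rest) with rank y ≡ᵇ a in lower
  ... | true = ⊥-elim (y≢a (≡ᵇ-true⇒≡ lower))
  ... | false with rank y ≡ᵇ suc a
  ...   | true  = refl
  ...   | false = lowerFirst-no-lower a M rest

  lowerFirst-no-upper : ∀ a M → All (λ y → rank y ≢ suc a) M →
                        lowerFirst a M ≡ not (count (inPair a) M ≡ᵇ 0)
  lowerFirst-no-upper a [] [] = refl
  lowerFirst-no-upper a (y ∷ M) (y≢a+1 ∷ rest) with rank y ≡ᵇ a
  ... | true = refl
  ... | false with rank y ≡ᵇ suc a in upper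
  ...   | true  = ⊥-elim (y≢a+1 (≡ᵇ-true⇒≡ upper))
  ...   | false = lowerFirst-no-upper a M rest

  inPair-bounds : ∀ a y → inPair a y ≡ true → (a ≤ rank y) × (rank y ≤ suc a)
  inPair-bounds a y y∈ with rank y ≡ᵇ a in lower | rank y ≡ᵇ suc a in upper
  ... | true  | _    = let y≡a = ≡ᵇ-true⇒≡ lower in
                       ≤-reflexive (sym y≡a) , ≤-trans (≤-reflexive y≡a) (n≤1+n a)
  ... | false | true = let y≡a+1 = ≡ᵇ-true⇒≡ upper in
                       ≤-trans (n≤1+n a) (≤-reflexive (sym y≡a+1)) , ≤-reflexive y≡a+1
  ... | false | false = ⊥-elim (false≢true y∈)

  pair-side : ∀ a x → rank x ≢ a → rank x ≢ suc a →
    Σ Bool λ s → ∀ y → inPair a y ≡ true → y ≻ x ≡ s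
  pair-side a x x≢a x≢a+1 with rank x <? a
  ... | yes x<a = true , λ y y∈ → <⇒<ᵇ-true (<-≤-trans x<a (proj₁ (inPair-bounds a y y∈)))
  ... | no  x≮a = false , λ y y∈ → ≥⇒<ᵇ-false (≤-trans (proj₂ (inPair-bounds a y y∈)) (<⇒≤ a+1<x))
    where
    a+1<x : suc a < rank x
    a+1<x = ≤∧≢⇒< (≤∧≢⇒< (≮⇒≥ x≮a) (x≢a ∘ sym)) (x≢a+1 ∘ sym)

  cut-constant : ∀ a c x s → (∀ y → inPair a y ≡ true → y ≻ x ≡ s) →
    ∀ y → inPair a y ≡ true → cut c x y ≡ (if c then s else not s)
  cut-constant a true  x s side y y∈ = side y y∈
  cut-constant a false x s side y y∈ = cong not (side y y∈)

  -- If no entry of L′ ↭ L has the rank r ∈ {a , a + 1}, the pair is represented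
  -- in them by at most its other member, so lowerFirst only depends on the
  -- multiset.
  lowerFirst-missing : ∀ a r L L′ → L′ ↭ L → All (λ y → rank y ≢ r) L → r ≡ a ⊎ r ≡ suc a →
                       lowerFirst a L′ ≡ lowerFirst a L
  lowerFirst-missing a r L L′ L′↭L r∉L (inj₁ refl) =
    trans (lowerFirst-no-lower a L′ (All-resp-↭ (↭-sym L′↭L) r∉L)) (sym (lowerFirst-no-lower a L r∉L))
  lowerFirst-missing a r L L′ L′↭L r∉L (inj₂ refl) =
    trans (lowerFirst-no-upper a L′ (All-resp-↭ (↭-sym L′↭L) r∉L))
      (trans (cong (λ k → not (k ≡ᵇ 0)) (count-↭ (inPair a) L′↭L)) (sym (lowerFirst-no-upper a L r∉L)))

  -- The rotation performed when inserting x keeps lowerFirst, provided the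
  -- rank of x does not occur in γ: if x is outside the pair, both entries of
  -- the pair fall on the same side of the cut.
  rotate-lowerFirst : ∀ a x γ R → γ ↭ R → All (λ y → rank x ≢ rank y) R →
    lowerFirst a γ ≡ lowerFirst a R → lowerFirst a (foataRotation x γ) ≡ lowerFirst a R
  rotate-lowerFirst a x γ R γ↭R x∉R same = by-rank (rank x ≟ a) (rank x ≟ suc a)
    where
    open ≡-Reasoning
    G↭R : foataRotation x γ ↭ R
    G↭R = ↭-trans (rotate-↭ (cutFor x γ) [] γ) γ↭R
    x∉R′ : All (λ y → rank y ≢ rank x) R
    x∉R′ = All-map (_∘ sym) x∉R
    inPair? : (y : A) → Dec (T (inPair a y))
    inPair? y = T? (inPair a y)
    by-rank : Dec (rank x ≡ a) → Dec (rank x ≡ suc a) → lowerFirst a (foataRotation x γ) ≡ lowerFirst a R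
    by-rank (yes x≡a) _            = lowerFirst-missing a (rank x) R _ G↭R x∉R′ (inj₁ x≡a)
    by-rank (no _)    (yes x≡a+1)  = lowerFirst-missing a (rank x) R _ G↭R x∉R′ (inj₂ x≡a+1)
    by-rank (no x≢a)  (no x≢a+1)   with pair-side a x x≢a x≢a+1
    ... | s , side = begin
      lowerFirst a (foataRotation x γ)                  ≡⟨ sym (lowerFirst-filter a (foataRotation x γ)) ⟩
      lowerFirst a (filter inPair? (foataRotation x γ)) ≡⟨ cong (lowerFirst a) (rotate-filter (inPair a) (cutFor x γ) _ [] γ [] same-side) ⟩
      lowerFirst a (filter inPair? γ)                   ≡⟨ lowerFirst-filter a γ ⟩
      lowerFirst a γ                                    ≡⟨ same ⟩
      lowerFirst a R                                    ∎
      where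
      same-side : ∀ y → inPair a y ≡ true → cutFor x γ y ≡ (if endsAbove x (last γ) then s else not s)
      same-side = cut-constant a (endsAbove x (last γ)) x s side

  foataRev-lowerFirst : ∀ a rs → DistinctRanks rs → lowerFirst a (foataRev rs) ≡ lowerFirst a (reverse rs)
  foataRev-lowerFirst a [] _ = refl
  foataRev-lowerFirst a (x ∷ rs) (x∉rs ∷ distinct) = begin
    lowerFirst a (foataRotation x γ ++ x ∷ [])  ≡⟨ lowerFirst-∷ʳ-cong a _ (reverse rs) x rotated↭ rotated ⟩
    lowerFirst a (reverse rs ++ x ∷ [])         ≡⟨ cong (lowerFirst a) (sym (unfold-reverse x rs)) ⟩
    lowerFirst a (reverse (x ∷ rs))             ∎
    where
    open ≡-Reasoning
    γ : List A
    γ = foataRev rs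
    rotated↭ : foataRotation x γ ↭ reverse rs
    rotated↭ = ↭-trans (rotate-↭ (cutFor x γ) [] γ) (foataRev-↭ rs)
    rotated : lowerFirst a (foataRotation x γ) ≡ lowerFirst a (reverse rs)
    rotated = rotate-lowerFirst a x γ (reverse rs) (foataRev-↭ rs)
                (All-resp-↭ (↭-sym (↭-reverse rs)) x∉rs) (foataRev-lowerFirst a rs distinct)

  foata-lowerFirst : ∀ a w → DistinctRanks w → lowerFirst a (foata w) ≡ lowerFirst a w
  foata-lowerFirst a w distinct = trans
    (foataRev-lowerFirst a (reverse w) (AllPairs-resp-↭ ≢-sym (↭-sym (↭-reverse w)) distinct))
    (cong (lowerFirst a) (reverse-involutive w))

toVec : ∀ {A : Set} (xs : List A) {m} → length xs ≡ m → Vec A m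
toVec [] {zero} _ = []
toVec (x ∷ xs) {suc m} eq = x ∷ toVec xs (suc-injective eq)

toList-toVec : ∀ {A : Set} (xs : List A) {m} (eq : length xs ≡ m) → toList (toVec xs eq) ≡ xs
toList-toVec [] {zero} _ = refl
toList-toVec (x ∷ xs) {suc m} eq = cong (x ∷_) (toList-toVec xs (suc-injective eq))

toList-injective′ : ∀ {A : Set} {m} (v v′ : Vec A m) → toList v ≡ toList v′ → v ≡ v′
toList-injective′ v v′ eq = trans (sym (cast-is-id refl v)) (toList-injective refl v v′ eq)

module SignedFoata (n : ℕ) where
  open Inversions (key {n})
  open Foata (key {n})
  open FoataMajor (key {n})
  open FoataPairOrder (key {n})

  Φ : SWord n → SWord n
  Φ w = toVec (foata (toList w)) (trans (foata-length (toList w)) (length-toList w))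

  toList-Φ : ∀ w → toList (Φ w) ≡ foata (toList w)
  toList-Φ w = toList-toVec (foata (toList w)) _

  Φ-↭ : ∀ w → toList (Φ w) ↭ toList w
  Φ-↭ w = subst (_↭ toList w) (sym (toList-Φ w)) (foata-↭ (toList w))

  Φ-injective : ∀ w w′ → Φ w ≡ Φ w′ → w ≡ w′
  Φ-injective w w′ eq = toList-injective′ w w′
    (foata-injective (toList w) (toList w′) (trans (sym (toList-Φ w)) (trans (cong toList eq) (toList-Φ w′))))

  invL≡inversions : ∀ xs → invL xs ≡ inversions xs
  invL≡inversions [] = refl
  invL≡inversions (x ∷ xs) = cong (count (x ≻_) xs +_) (invL≡inversions xs)

  majFrom≡majorFrom : ∀ p xs → majFrom p xs ≡ majorFrom p xs
  majFrom≡majorFrom p [] = refl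
  majFrom≡majorFrom p (x ∷ []) = refl
  majFrom≡majorFrom p (x ∷ y ∷ ys) = cong ((if x ≻ y then p else 0) +_) (majFrom≡majorFrom (suc p) (y ∷ ys))

  barL≡count : ∀ (xs : List (Letter n)) → barL xs ≡ count proj₂ xs
  barL≡count [] = refl
  barL≡count ((v , true) ∷ xs) = cong suc (barL≡count xs)
  barL≡count ((v , false) ∷ xs) = barL≡count xs

  inv-Φ : ∀ w → inv (Φ w) ≡ maj w
  inv-Φ w = begin
    invL (toList (Φ w))            ≡⟨ invL≡inversions (toList (Φ w)) ⟩
    inversions (toList (Φ w))      ≡⟨ cong inversions (toList-Φ w) ⟩
    inversions (foata (toList w))  ≡⟨ foata-inversions (toList w) ⟩
    majorFrom 1 (toList w)         ≡⟨ sym (majFrom≡majorFrom 1 (toList w)) ⟩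
    majFrom 1 (toList w)           ∎
    where open ≡-Reasoning

  bar-Φ : ∀ w → bar (Φ w) ≡ bar w
  bar-Φ w = trans (barL≡count (toList (Φ w))) (trans (count-↭ proj₂ (Φ-↭ w)) (sym (barL≡count (toList w))))

  finv-Φ : ∀ w → finv (Φ w) ≡ fmaj w
  finv-Φ w = cong₂ (λ i b → 2 * i + b) (inv-Φ w) (bar-Φ w)

  Distinct : List (Letter n) → Set
  Distinct = AllPairs (λ x y → proj₁ x ≢ proj₁ y)

  key-injective : ∀ (x y : Letter n) → key x ≡ key y → x ≡ y
  key-injective (v , true)  (v′ , true)  eq = cong (_, true) (toℕ-injective eq)
  key-injective (v , false) (v′ , false) eq = cong (_, false) (toℕ-injective (+-cancelˡ-≡ n _ _ eq))
  key-injective (v , true)  (v′ , false) eq = ⊥-elim (<-irrefl eq (<-≤-trans (toℕ<n v) (m≤m+n n (toℕ v′))))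
  key-injective (v , false) (v′ , true)  eq = ⊥-elim (<-irrefl (sym eq) (<-≤-trans (toℕ<n v′) (m≤m+n n (toℕ v))))

  distinct-ranks : ∀ L → Distinct L → DistinctRanks L
  distinct-ranks L = AllPairs-map (λ {x} {y} x≢y eq → x≢y (cong proj₁ (key-injective x y eq)))

  consecutive-keys : ∀ j j′ b → toℕ j′ ≡ suc (toℕ j) → key {n} (j′ , b) ≡ suc (key (j , b))
  consecutive-keys j j′ true  e = e
  consecutive-keys j j′ false e = trans (cong (n +_) e) (+-suc n (toℕ j))

  -- The letter of value j in the inverse of the word L, whose positions are
  -- listed by is (Defs.inverse uses is = allFin n).
  preimage : Fin n → List (Fin n) → List (Letter n) → Letter n
  preimage j is L = findPre j (zip is L)

  position : Fin n → List (Fin n) → List (Letter n) → ℕ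
  position j is L = toℕ (proj₁ (preimage j is L))

  preimage-position : ∀ j b is L → length is ≡ length L → (j , b) ∈ L → proj₁ (preimage j is L) ∈ is
  preimage-position j b (i ∷ is) ((v , c) ∷ L) eq j∈L with v ≟ᶠ j | j∈L
  ... | yes _  | _           = here refl
  ... | no v≢j | here refl   = ⊥-elim (v≢j refl)
  ... | no _   | there j∈L′ = there (preimage-position j b is L (suc-injective eq) j∈L′)

  preimage-bar : ∀ j b is L → length is ≡ length L → Distinct L → (j , b) ∈ L →
                 proj₂ (preimage j is L) ≡ b
  preimage-bar j b (i ∷ is) ((v , c) ∷ L) eq (v∉L ∷ distinct) j∈L with v ≟ᶠ j | j∈L
  ... | yes _    | here refl   = refl
  ... | yes refl | there j∈L′ = ⊥-elim (All-lookup v∉L j∈L′ refl)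
  ... | no v≢j   | here refl   = ⊥-elim (v≢j refl)
  ... | no _     | there j∈L′ = preimage-bar j b is L (suc-injective eq) distinct j∈L′

  Increasing : List (Fin n) → Set
  Increasing = AllPairs (λ i i′ → toℕ i < toℕ i′)

  preimage-order : ∀ j j′ b is L → Increasing is → length is ≡ length L → Distinct L →
    (j , b) ∈ L → (j′ , b) ∈ L → key (j′ , b) ≡ suc (key (j , b)) →
    (position j′ is L <ᵇ position j is L) ≡ not (lowerFirst (key (j , b)) L)
  preimage-order j j′ b (i ∷ is) ((v , c) ∷ L) (i< ∷ increasing) eq (v∉L ∷ distinct) j∈ j′∈ consecutive
    with v ≟ᶠ j | v ≟ᶠ j′ | j∈ | j′∈
  ... | yes refl | _ | there j∈L | _ = ⊥-elim (All-lookup v∉L j∈L refl)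
  ... | _ | yes refl | _ | there j′∈L = ⊥-elim (All-lookup v∉L j′∈L refl)
  ... | yes refl | yes refl | here refl | here refl = ⊥-elim (n≢1+n _ consecutive)
  ... | yes refl | no _ | here refl | here refl = ⊥-elim (n≢1+n _ consecutive)
  ... | no _ | yes refl | here refl | here refl = ⊥-elim (n≢1+n _ consecutive)
  ... | no v≢j | _ | here refl | _ = ⊥-elim (v≢j refl)
  ... | _ | no v≢j′ | _ | here refl = ⊥-elim (v≢j′ refl)
  ... | yes refl | no _ | here refl | there j′∈L rewrite ≡ᵇ-refl (key (v , c)) =
    ≥⇒<ᵇ-false (<⇒≤ (All-lookup i< (preimage-position j′ c is L (suc-injective eq) j′∈L)))
  ... | no _ | yes refl | there j∈L | here refl
    rewrite consecutive | ≢⇒≡ᵇ-false (n≢1+n (key (j , c)) ∘ sym) | ≡ᵇ-refl (key (j , c)) =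
    <⇒<ᵇ-true (All-lookup i< (preimage-position j c is L (suc-injective eq) j∈L))
  ... | no v≢j | no v≢j′ | there j∈L | there j′∈L
    rewrite ≢⇒≡ᵇ-false (λ e → v≢j (cong proj₁ (key-injective (v , c) (j , b) e)))
          | ≢⇒≡ᵇ-false (λ e → v≢j′ (cong proj₁ (key-injective (v , c) (j′ , b) (trans e (sym consecutive))))) =
    preimage-order j j′ b is L increasing (suc-injective eq) distinct j∈L j′∈L consecutive

  descentMark : Letter n → Letter n → Maybe Sign
  descentMark p q = if (p >r q) ∨ (proj₂ p ∧ not (proj₂ q)) then just (signOf (proj₂ p)) else nothing

  markByBars : Bool → Bool → Bool → Maybe Sign
  markByBars true  true  greater = if greater then just minus else nothing
  markByBars false false greater = if greater then just plus else nothing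
  markByBars true  false _ = just minus
  markByBars false true  _ = just plus

  +-<ᵇ-cancel : ∀ k x y → (k + x <ᵇ k + y) ≡ (x <ᵇ y)
  +-<ᵇ-cancel zero    x y = refl
  +-<ᵇ-cancel (suc k) x y = +-<ᵇ-cancel k x y

  descentMark-byBars : ∀ p q → descentMark p q ≡ markByBars (proj₂ p) (proj₂ q) (toℕ (proj₁ q) <ᵇ toℕ (proj₁ p))
  descentMark-byBars (i , true)  (i′ , true)  rewrite ∨-identityʳ (toℕ i′ <ᵇ toℕ i) = refl
  descentMark-byBars (i , false) (i′ , false) rewrite +-<ᵇ-cancel n (toℕ i′) (toℕ i) | ∨-identityʳ (toℕ i′ <ᵇ toℕ i) = refl
  descentMark-byBars (i , true)  (i′ , false) rewrite ∨-zeroʳ (n + toℕ i′ <ᵇ toℕ i) = refl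
  descentMark-byBars (i , false) (i′ , true)  rewrite <⇒<ᵇ-true (<-≤-trans (toℕ<n i′) (m≤m+n n (toℕ i))) = refl

  sDesL-tabulate-cong : ∀ k (G G′ : Fin k → Letter n) →
    (∀ i → proj₂ (G i) ≡ proj₂ (G′ i)) →
    (∀ i i′ → toℕ i′ ≡ suc (toℕ i) → descentMark (G i) (G i′) ≡ descentMark (G′ i) (G′ i′)) →
    sDesL (toList (tabulate G)) ≡ sDesL (toList (tabulate G′))
  sDesL-tabulate-cong zero G G′ same-bars same-marks = refl
  sDesL-tabulate-cong (suc zero) G G′ same-bars same-marks = cong (λ b → just (signOf b) ∷ []) (same-bars fzero)
  sDesL-tabulate-cong (suc (suc k)) G G′ same-bars same-marks =
    cong₂ _∷_ (same-marks fzero (fsuc fzero) refl)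
      (sDesL-tabulate-cong (suc k) (G ∘ fsuc) (G′ ∘ fsuc) (same-bars ∘ fsuc)
        (λ i i′ e → same-marks (fsuc i) (fsuc i′) (cong suc e)))

  values↭allFin : ∀ L → Distinct L → length L ≡ n → map proj₁ L ↭ allFin n
  values↭allFin L distinct len =
    unique-⊆-↭ (map proj₁ L) (allFin n) (AllPairs-map⁺ distinct) (allFin⁺ n) (λ {j} _ → ∈-allFin j)
      (≤-reflexive (trans (length-tabulate (λ j → j)) (sym (trans (length-map proj₁ L) len))))

  every-value-occurs : ∀ L → Distinct L → length L ≡ n → ∀ j → Σ Bool λ b → (j , b) ∈ L
  every-value-occurs L distinct len j
    with ∈-map⁻ proj₁ (∈-resp-↭ (↭-sym (values↭allFin L distinct len)) (∈-allFin j))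
  ... | (v , b) , v∈L , refl = b , v∈L

  inverseAt : List (Letter n) → Fin n → Letter n
  inverseAt L j = preimage j (allFin n) L

  length-allFin : ∀ (L : List (Letter n)) → length L ≡ n → length (allFin n) ≡ length L
  length-allFin L len = trans (length-tabulate (λ j → j)) (sym len)

  inverse-bar : ∀ L → Distinct L → length L ≡ n → ∀ {j b} → (j , b) ∈ L → proj₂ (inverseAt L j) ≡ b
  inverse-bar L distinct len {j} {b} = preimage-bar j b (allFin n) L (length-allFin L len) distinct

  inverse-mark : ∀ L → Distinct L → length L ≡ n → ∀ {j j′ b c} → toℕ j′ ≡ suc (toℕ j) →
    (j , b) ∈ L → (j′ , c) ∈ L →
    descentMark (inverseAt L j) (inverseAt L j′) ≡ markByBars b c (not (lowerFirst (key (j , b)) L))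
  inverse-mark L distinct len {j} {j′} {b} {c} consecutive j∈L j′∈L
    rewrite descentMark-byBars (inverseAt L j) (inverseAt L j′)
          | inverse-bar L distinct len j∈L | inverse-bar L distinct len j′∈L = by-bars b c j∈L j′∈L
    where
    ordered : ∀ b → (j , b) ∈ L → (j′ , b) ∈ L →
      (position j′ (allFin n) L <ᵇ position j (allFin n) L) ≡ not (lowerFirst (key (j , b)) L)
    ordered b j∈L j′∈L = preimage-order j j′ b (allFin n) L (tabulate⁺-< (λ i<i′ → i<i′)) (length-allFin L len)
      distinct j∈L j′∈L (consecutive-keys j j′ b consecutive)
    by-bars : ∀ b c → (j , b) ∈ L → (j′ , c) ∈ L →
      markByBars b c (position j′ (allFin n) L <ᵇ position j (allFin n) L) ≡ markByBars b c (not (lowerFirst (key (j , b)) L))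
    by-bars true  false _ _ = refl
    by-bars false true  _ _ = refl
    by-bars true  true  j∈L j′∈L = cong (markByBars true true) (ordered true j∈L j′∈L)
    by-bars false false j∈L j′∈L = cong (markByBars false false) (ordered false j∈L j′∈L)

  sDes-inverse-Φ : ∀ w → Distinct (toList w) → sDes (inverse (Φ w)) ≡ sDes (inverse w)
  sDes-inverse-Φ w distinct = sDesL-tabulate-cong n (inverseAt L′) (inverseAt L) same-bars same-marks
    where
    L L′ : List (Letter n)
    L  = toList w
    L′ = toList (Φ w)
    moved : ∀ {x} → x ∈ L → x ∈ L′
    moved = ∈-resp-↭ (↭-sym (Φ-↭ w))
    distinct′ : Distinct L′
    distinct′ = AllPairs-resp-↭ (_∘ sym) (↭-sym (Φ-↭ w)) distinct
    occurs : ∀ j → Σ Bool λ b → (j , b) ∈ L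
    occurs = every-value-occurs L distinct (length-toList w)
    same-bars : ∀ j → proj₂ (inverseAt L′ j) ≡ proj₂ (inverseAt L j)
    same-bars j = trans (inverse-bar L′ distinct′ (length-toList (Φ w)) (moved (proj₂ (occurs j))))
                        (sym (inverse-bar L distinct (length-toList w) (proj₂ (occurs j))))
    same-marks : ∀ j j′ → toℕ j′ ≡ suc (toℕ j) →
      descentMark (inverseAt L′ j) (inverseAt L′ j′) ≡ descentMark (inverseAt L j) (inverseAt L j′)
    same-marks j j′ consecutive = begin
      descentMark (inverseAt L′ j) (inverseAt L′ j′)
        ≡⟨ inverse-mark L′ distinct′ (length-toList (Φ w)) consecutive (moved j∈L) (moved j′∈L) ⟩
      markByBars b c (not (lowerFirst (key (j , b)) L′))
        ≡⟨ cong (λ M → markByBars b c (not (lowerFirst (key (j , b)) M))) (toList-Φ w) ⟩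
      markByBars b c (not (lowerFirst (key (j , b)) (foata L)))
        ≡⟨ cong (markByBars b c ∘ not) (foata-lowerFirst (key (j , b)) L (distinct-ranks L distinct)) ⟩
      markByBars b c (not (lowerFirst (key (j , b)) L))
        ≡⟨ sym (inverse-mark L distinct (length-toList w) consecutive j∈L j′∈L) ⟩
      descentMark (inverseAt L j) (inverseAt L j′) ∎
      where
      open ≡-Reasoning
      b c : Bool
      b = proj₁ (occurs j)
      c = proj₁ (occurs j′)
      j∈L : (j , b) ∈ L
      j∈L = proj₂ (occurs j)
      j′∈L : (j′ , c) ∈ L
      j′∈L = proj₂ (occurs j′)

concatMap-map : ∀ {A B C : Set} (f : A → B → C) xs ys →
                concatMap (λ x → map (f x) ys) xs ≡ cartesianProductWith f xs ys
concatMap-map f [] ys = refl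
concatMap-map f (x ∷ xs) ys = cong (map (f x) ys ++_) (concatMap-map f xs ys)

unique-allVecs : ∀ {A : Set} (xs : List A) m → Unique xs → Unique (allVecs xs m)
unique-allVecs xs zero _ = [] ∷ []
unique-allVecs xs (suc m) unique = subst Unique (sym (concatMap-map _∷_ xs (allVecs xs m)))
  (cartesianProductWith⁺ _∷_ ∷-injective unique (unique-allVecs xs m unique))

∈-allVecs : ∀ {A : Set} (xs : List A) m → (∀ a → a ∈ xs) → ∀ v → v ∈ allVecs xs m
∈-allVecs xs zero every [] = here refl
∈-allVecs xs (suc m) every (a ∷ v) = subst (a ∷ v ∈_) (sym (concatMap-map _∷_ xs (allVecs xs m)))
  (∈-cartesianProductWith⁺ _∷_ (every a) (∈-allVecs xs m every v))

module SignedPermutations (n : ℕ) where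
  open SignedFoata n

  ,-injective : ∀ {v v′ : Fin n} {b b′ : Bool} → (v , b) ≡ (v′ , b′) → v ≡ v′ × b ≡ b′
  ,-injective refl = refl , refl

  unique-allLetters : Unique (allLetters n)
  unique-allLetters = subst Unique (sym (concatMap-map _,_ (allFin n) (false ∷ true ∷ [])))
    (cartesianProductWith⁺ _,_ ,-injective (allFin⁺ n) (((λ ()) ∷ []) ∷ [] ∷ []))

  ∈-allLetters : ∀ (l : Letter n) → l ∈ allLetters n
  ∈-allLetters (v , b) = subst ((v , b) ∈_) (sym (concatMap-map _,_ (allFin n) (false ∷ true ∷ [])))
    (∈-cartesianProductWith⁺ _,_ (∈-allFin v) (bool∈ b))
    where
    bool∈ : ∀ b → b ∈ false ∷ true ∷ []
    bool∈ false = here refl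
    bool∈ true  = there (here refl)

  sharesNoValue : ∀ (x : Letter n) (xs : List (Letter n)) → not (any (λ y → ⌊ proj₁ x ≟ᶠ proj₁ y ⌋) xs) ≡ true →
                  All (λ y → proj₁ x ≢ proj₁ y) xs
  sharesNoValue x [] _ = []
  sharesNoValue x (y ∷ ys) none with proj₁ x ≟ᶠ proj₁ y
  ... | yes _  = ⊥-elim (false≢true none)
  ... | no x≢y = x≢y ∷ sharesNoValue x ys none

  sharesNoValue⁻¹ : ∀ (x : Letter n) (xs : List (Letter n)) → All (λ y → proj₁ x ≢ proj₁ y) xs →
                    not (any (λ y → ⌊ proj₁ x ≟ᶠ proj₁ y ⌋) xs) ≡ true
  sharesNoValue⁻¹ x [] [] = refl
  sharesNoValue⁻¹ x (y ∷ ys) (x≢y ∷ rest) with proj₁ x ≟ᶠ proj₁ y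
  ... | yes x≡y = ⊥-elim (x≢y x≡y)
  ... | no _    = sharesNoValue⁻¹ x ys rest

  distinct⇒Distinct : ∀ L → distinct L ≡ true → Distinct L
  distinct⇒Distinct [] _ = []
  distinct⇒Distinct (x ∷ L) eq with not (any (λ y → ⌊ proj₁ x ≟ᶠ proj₁ y ⌋) L) in head-ok
  ... | true = sharesNoValue x L head-ok ∷ distinct⇒Distinct L eq

  Distinct⇒distinct : ∀ L → Distinct L → distinct L ≡ true
  Distinct⇒distinct [] [] = refl
  Distinct⇒distinct (x ∷ L) (x∉L ∷ rest) =
    trans (cong (_∧ distinct L) (sharesNoValue⁻¹ x L x∉L)) (Distinct⇒distinct L rest)

  signedPerm? : (w : SWord n) → Dec (T (isSignedPerm w))
  signedPerm? w = T? (isSignedPerm w)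

  in-Bn⇒Distinct : ∀ {w} → w ∈ Bn n → Distinct (toList w)
  in-Bn⇒Distinct {w} w∈ =
    distinct⇒Distinct (toList w) (T-true (proj₂ (∈-filter⁻ signedPerm? {xs = allVecs (allLetters n) n} w∈)))
    where
    T-true : ∀ {b} → T b → b ≡ true
    T-true {true} _ = refl

  Φ-in-Bn : ∀ {w} → w ∈ Bn n → Φ w ∈ Bn n
  Φ-in-Bn {w} w∈ = ∈-filter⁺ signedPerm? (∈-allVecs (allLetters n) n ∈-allLetters (Φ w))
    (subst T (sym (Distinct⇒distinct (toList (Φ w))
      (AllPairs-resp-↭ (_∘ sym) (↭-sym (Φ-↭ w)) (in-Bn⇒Distinct w∈)))) _)

  unique-Bn : Unique (Bn n)
  unique-Bn = Unique-filter⁺ signedPerm? (unique-allVecs (allLetters n) n unique-allLetters)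

  Φ-permutes-Bn : map Φ (Bn n) ↭ Bn n
  Φ-permutes-Bn = unique-⊆-↭ (map Φ (Bn n)) (Bn n)
    (Unique-map⁺ (λ {w} {w′} → Φ-injective w w′) unique-Bn) unique-Bn image⊆Bn
    (≤-reflexive (sym (length-map Φ (Bn n))))
    where
    image⊆Bn : ∀ {v} → v ∈ map Φ (Bn n) → v ∈ Bn n
    image⊆Bn v∈ with ∈-map⁻ Φ v∈
    ... | w , w∈ , refl = Φ-in-Bn w∈

-- Imported only here: the integer constructor +_ would make the sections
-- (n +_) of natural-number addition used above ambiguous.
open import Data.Integer using (ℤ; +_)
open import Data.Integer.Properties using () renaming (_≟_ to _≟ℤ_)

proposition6p2 : (m : ℕ) (k : ℤ) (σ : Vec (Maybe Sign) (suc m)) → InSigmaB σ →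
    countB (suc m) (λ w → eqList (sDes (inverse w)) (toList σ) ∧ ⌊ + finv w ≟ℤ k ⌋)
      ≡ countB (suc m) (λ w → eqList (sDes (inverse w)) (toList σ) ∧ ⌊ + fmaj w ≟ℤ k ⌋)
proposition6p2 m k σ _ = begin
  count (selected finv) (Bn n)      ≡⟨ count-transport (selected finv) Φ (Bn n) Φ-permutes-Bn ⟩
  count (selected finv ∘ Φ) (Bn n)  ≡⟨ count-cong (selected finv ∘ Φ) (selected fmaj) (Bn n) same-selection ⟩
  count (selected fmaj) (Bn n)      ∎
  where
  open ≡-Reasoning
  n : ℕ
  n = suc m
  open SignedFoata n
  open SignedPermutations n
  selected : (SWord n → ℕ) → SWord n → Bool
  selected stat w = eqList (sDes (inverse w)) (toList σ) ∧ ⌊ + stat w ≟ℤ k ⌋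
  same-selection : ∀ {w} → w ∈ Bn n → selected finv (Φ w) ≡ selected fmaj w
  same-selection {w} w∈ rewrite sDes-inverse-Φ w (in-Bn⇒Distinct w∈) | finv-Φ w = refl
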